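{- Let $k,m$ be positive integers. If every prime divisor of $k$ lies in $T_m$, then every positive divisor of $k$ (including $k$) lies in $T_m$. Conversely, if $k\in T_m$, then every positive divisor of $k$ lies in $T_m$.
   Context: For a positive integer $m$, $T_m$ is the unique set of positive integers determined by: (i) $1\in T_m$; (ii) a prime $p$ lies in $T_m$ if and only if $p-m\in T_m$; (iii) a composite $x$ lies in $T_m$ if and only if there exist $x_1,x_2\in T_m$ with $x_1,x_2>1$ and $x_1x_2=x$. (Since $T_m\subseteq\mathbb{N}$, $p-m\in T_m$ requires $p-m\geq 1$.) -}

module Defs where

open import Data.Nat using (ℕ; _*_; _∸_; _<_)
open import Data.Nat.Primality using (Prime; Composite)
open import Relation.Binary.PropositionalEquality using (_≡_)

-- Since all clauses refer only to strictly smaller numbers, the least set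
-- closed under them is the unique set of the paper; the "only if" directions
-- hold by inversion on this inductive type.
data T (m : ℕ) : ℕ → Set where
  t-one   : T m 1
  t-prime : ∀ {p} → Prime p → m < p → T m (p ∸ m) → T m p
  t-comp  : ∀ {x x₁ x₂} → Composite x → 1 < x₁ → 1 < x₂ → x₁ * x₂ ≡ x →
            T m x₁ → T m x₂ → T m x

{-# OPTIONS --safe #-}
module Submission where

-- T m contains 1 and every composite that is a product of two members, so by
-- strong induction on d it contains each divisor d of k once it contains the
-- primes dividing k.  Conversely the prime divisors of a member of T m are in
-- T m: a prime dividing a product divides a factor (Euclid), and a prime
-- dividing a prime equals it.

open import Defs
open import Data.Nat using (ℕ; _<_; zero; suc)
open import Data.Nat.Base using (nonTrivial⇒n>1)
open import Data.Nat.Divisibility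
open import Data.Nat.Primality
open import Data.Nat.Induction using (<-rec)
open import Data.Nat.Properties using (<-irrefl)
open import Data.Product using (_×_; _,_)
open import Data.Sum using (inj₁; inj₂)
open import Data.Empty using (⊥-elim)
open import Relation.Nullary using (yes; no)
open import Relation.Binary.PropositionalEquality using (refl; sym)

T-primeDivisors⇒T-divisors : ∀ {k m} → 0 < k →
  (∀ p → Prime p → p ∣ k → T m p) → ∀ d → d ∣ k → T m d
T-primeDivisors⇒T-divisors {k} {m} k>0 T-primes = <-rec (λ d → d ∣ k → T m d) step
  where
  step : ∀ d → (∀ {e} → e < d → e ∣ k → T m e) → d ∣ k → T m d
  step zero _ 0∣k with 0∣⇒≡0 0∣k
  ... | refl = ⊥-elim (<-irrefl refl k>0)
  step (suc zero) _ _ = t-one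
  step d@(suc (suc _)) ih d∣k with prime? d
  ... | yes d-prime = T-primes d d-prime d∣k
  ... | no d-notPrime with ¬prime⇒composite d-notPrime
  ... | d-comp@(composite {e} e<d e∣d) =
    t-comp d-comp (nonTrivial⇒n>1 e) (quotient>1 e∣d e<d) (sym (m∣n⇒n≡m*quotient e∣d))
      (ih e<d (∣-trans e∣d d∣k))
      (ih (quotient-< e∣d) (∣-trans (quotient-∣ e∣d) d∣k))

T⇒T-primeDivisors : ∀ {m x} → T m x → ∀ p → Prime p → p ∣ x → T m p
T⇒T-primeDivisors t-one p p-prime p∣1 with ∣1⇒≡1 p∣1
... | refl = ⊥-elim (¬prime[1] p-prime)
T⇒T-primeDivisors (t-prime q-prime m<q tq) p p-prime p∣q with prime⇒irreducible q-prime p∣q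
... | inj₁ refl = ⊥-elim (¬prime[1] p-prime)
... | inj₂ refl = t-prime q-prime m<q tq
T⇒T-primeDivisors (t-comp {x₁ = x₁} {x₂ = x₂} _ _ _ refl t₁ t₂) p p-prime p∣x
  with euclidsLemma x₁ x₂ p-prime p∣x
... | inj₁ p∣x₁ = T⇒T-primeDivisors t₁ p p-prime p∣x₁
... | inj₂ p∣x₂ = T⇒T-primeDivisors t₂ p p-prime p∣x₂

lemma1p1 : (k m : ℕ) → 0 < k → 0 < m →
    (((∀ p → Prime p → p ∣ k → T m p) → ∀ d → d ∣ k → T m d)
    × (T m k → ∀ d → d ∣ k → T m d))
lemma1p1 k m k>0 _ =
  T-primeDivisors⇒T-divisors k>0 ,
  λ k∈T → T-primeDivisors⇒T-divisors k>0 (T⇒T-primeDivisors k∈T)
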